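{- Let $n,m\ge1$, let $m=p_1^{e_1}p_2^{e_2}\cdots p_\ell^{e_\ell}$ be the prime factorization of $m$, and let $CP(n,m)$ be the number of congruence preserving functions $\mathbb{Z}/n\mathbb{Z}\to\mathbb{Z}/m\mathbb{Z}$. Then $$CP(n,m)=\prod_{i=1}^{\ell} p_i^{\,p_i+p_i^2+\cdots+p_i^{e_i}}\quad\text{if } n\ge\mu(m),$$ and, if $n<\mu(m)$, $$CP(n,m)=\prod_{\{i\,\mid\,p_i^{e_i}\le n\}} p_i^{\,p_i+p_i^2+\cdots+p_i^{e_i}}\times\prod_{\{i\,\mid\,p_i^{e_i}>n\}} p_i^{\,p_i+p_i^2+\cdots+p_i^{l_i}+n(e_i-l_i)},$$ where $l_i=\lfloor\log_{p_i}n\rfloor$ (and an empty sum in an exponent is $0$).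
   Context: Elements of $\mathbb{Z}/n\mathbb{Z}$ are represented by $\{0,\dots,n-1\}$. A function $f:\mathbb{Z}/n\mathbb{Z}\to\mathbb{Z}/m\mathbb{Z}$ is congruence preserving if for every positive divisor $d$ of $m$ and all $a,b\in\{0,\dots,n-1\}$, $a\equiv b\pmod d$ implies $f(a)\equiv f(b)\pmod d$. $\mu(m)=\max_i p_i^{e_i}$ is the largest prime power dividing $m$. -}

module Defs where

open import Data.Nat using (ℕ; zero; suc; _+_; _*_; _∸_; _^_; _≤_; _<_; _⊔_; ∣_-_∣; _≤?_)
open import Data.Nat.Divisibility using (_∣_)
open import Data.Fin using (Fin; zero; suc; toℕ)
open import Data.Vec using (Vec; lookup)
open import Data.List using (List; length)
open import Data.List.Membership.Propositional using (_∈_)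
open import Data.List.Relation.Unary.Unique.Propositional using (Unique)
open import Data.Product using (Σ; _×_)
open import Function.Bundles using (_⇔_)
open import Relation.Nullary.Decidable using (⌊_⌋)
open import Data.Bool using (if_then_else_)
open import Relation.Binary.PropositionalEquality using (_≡_)

_≡_[mod_] : ℕ → ℕ → ℕ → Set
a ≡ b [mod d ] = d ∣ ∣ a - b ∣

-- A function Z/nZ → Z/mZ, represented by its table of values
-- (the value at a ∈ {0..n-1} is  lookup f a ∈ {0..m-1}).
CongruencePreserving : (n m : ℕ) → Vec (Fin m) n → Set
CongruencePreserving n m f =
  (d : ℕ) → 1 ≤ d → d ∣ m → (a b : Fin n) →
  toℕ a ≡ toℕ b [mod d ] → toℕ (lookup f a) ≡ toℕ (lookup f b) [mod d ]

HasCount : {A : Set} → (A → Set) → ℕ → Set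
HasCount {A} P N =
  Σ (List A) λ L → Unique L × ((x : A) → (x ∈ L) ⇔ P x) × (length L ≡ N)

CPCount : ℕ → ℕ → ℕ → Set
CPCount n m N = HasCount (CongruencePreserving n m) N

∏ : {ℓ : ℕ} → (Fin ℓ → ℕ) → ℕ
∏ {zero}  f = 1
∏ {suc ℓ} f = f zero * ∏ (λ i → f (suc i))

maxF : {ℓ : ℕ} → (Fin ℓ → ℕ) → ℕ
maxF {zero}  f = 0
maxF {suc ℓ} f = f zero ⊔ maxF (λ i → f (suc i))

powSum : ℕ → ℕ → ℕ
powSum p zero    = 0
powSum p (suc k) = powSum p k + p ^ suc k

module Submission where

-- The proofs use the equivalent formulation "preserves remainders
-- modulo every nonzero divisor d of m", since remainders turn congruences into
-- equalities.  The count is obtained in three layers.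
--  * Peeling a prime: if every divisor of p·q divides q or is p·q itself, a
--    congruence preserving f into Z/pqZ splits as f = q·h + g, where g is
--    congruence preserving into Z/qZ and h is an arbitrary (pq)-periodic vector
--    over Fin p; there are p^(min n (pq)) such h.  Iterating over q = p^e gives
--    CP(n, p^e) = p^(Σ_{k=1..e} min(n, p^k)).
--  * Chinese remainder theorem: for coprime q, r the pairs (f mod q, f mod r)
--    identify CP(n, qr) with CP(n, q) × CP(n, r), so the count is multiplicative
--    over pairwise coprime factors.
--  * Arithmetic: Σ_{k=1..e} min(n, p^k) equals p + … + p^e when p^e ≤ n, and
--    p + … + p^l + n(e − l) when p^l ≤ n < p^(l+1) ≤ p^e.

open import Defs
open import Data.Nat using (ℕ; zero; suc; _+_; _*_; _∸_; _^_; _≤_; _<_; _≤?_; _<?_; _⊓_; ∣_-_∣; NonZero; _%_; s≤s; >-nonZero; >-nonZero⁻¹; ≢-nonZero; ≢-nonZero⁻¹)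
open import Data.Nat.Properties
open import Data.Nat.DivMod using (_/_; _mod_; m≡m%n+[m/n]*n; %-remove-+ˡ; %-remove-+ʳ; [m+kn]%n≡m%n; m<n⇒m%n≡m; m%n%n≡m%n; m∣n⇒o%n%m≡o%m; %-distribˡ-*)
open import Data.Nat.Divisibility hiding (quotient)
open import Data.Nat.GCD using (gcd; gcd[m,n]∣m; gcd[m,n]∣n; gcd-greatest; gcd-comm; c*gcd[m,n]≡gcd[cm,cn]; gcd[m,n]≢0; module Bézout)
open import Data.Nat.Coprimality using (Coprime; coprime-divisor; coprime-Bézout; 1-coprimeTo)
import Data.Nat.Coprimality as Coprimality
open import Data.Nat.Primality using (Prime; prime⇒irreducible; prime⇒nonZero; ¬prime[1])
open import Data.Nat.Solver using (module +-*-Solver)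
open import Data.Fin using (Fin; zero; suc; toℕ; fromℕ<; combine; quotient; remainder)
open import Data.Fin.Properties using (toℕ<n; toℕ-fromℕ<; toℕ-combine; combine-injective; combine-remQuot; toℕ-injective) renaming (0≢1+n to zero≢suc; suc-injective to Fin-suc-injective)
open import Data.Vec using (Vec; []; _∷_; lookup; zipWith; map; replicate; tabulate)
open import Data.Vec.Properties using (lookup-zipWith; lookup-map; lookup-replicate; tabulate∘lookup; tabulate-cong; ∷-injective; ∷-injectiveʳ)
open import Data.List using (List; []; _∷_; length; cartesianProductWith; allFin)
import Data.List as List
open import Data.List.Properties using (length-++; length-map; length-tabulate)
open import Data.List.Membership.Propositional using (_∈_)
open import Data.List.Membership.Propositional.Properties using (∈-cartesianProductWith⁺; ∈-cartesianProductWith⁻; ∈-allFin)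
open import Data.List.Relation.Unary.Unique.Propositional.Properties using (cartesianProductWith⁺; allFin⁺)
open import Data.List.Relation.Unary.Any using (here)
import Data.List.Relation.Unary.AllPairs as AllPairs
import Data.List.Relation.Unary.All as All
open import Data.Product using (Σ; _×_; _,_; proj₁; proj₂)
open import Data.Sum using (_⊎_; inj₁; inj₂)
open import Data.Unit using (⊤; tt)
open import Data.Empty using (⊥-elim)
open import Function using (_∘_)
open import Function.Bundles using (_⇔_; mk⇔; Equivalence)
import Function.Properties.Equivalence as ⇔
open import Relation.Nullary using (yes; no)
open import Relation.Nullary.Decidable using (⌊_⌋)
open import Data.Bool using (if_then_else_)
open import Relation.Binary.PropositionalEquality using (_≡_; _≢_; refl; sym; trans; cong; cong₂; subst; module ≡-Reasoning)
open import Function.Definitions using (Injective)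

open ≡-Reasoning

count-≡ : {A : Set} {P : A → Set} {M N : ℕ} → M ≡ N → HasCount P M → HasCount P N
count-≡ refl c = c

count-⇔ : {A : Set} {P Q : A → Set} {N : ℕ} → (∀ x → P x ⇔ Q x) → HasCount P N → HasCount Q N
count-⇔ P⇔Q (L , unique , members , len) = L , unique , (λ x → ⇔.trans (members x) (P⇔Q x)) , len

count-single : {A : Set} {P : A → Set} (x₀ : A) → P x₀ → (∀ x → P x → x ≡ x₀) → HasCount P 1
count-single {P = P} x₀ px₀ only = (x₀ ∷ []) , (All.[] AllPairs.∷ AllPairs.[]) , (λ x → mk⇔ (member x) (here ∘ only x)) , refl
  where
  member : ∀ x → x ∈ (x₀ ∷ []) → P x
  member x (here refl) = px₀

count-Fin : (c : ℕ) → HasCount {Fin c} (λ _ → ⊤) c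
count-Fin c = allFin c , allFin⁺ c , (λ x → mk⇔ (λ _ → tt) (λ _ → ∈-allFin x)) , length-tabulate (λ i → i)

length-cartesianProductWith : {A B C : Set} (f : A → B → C) (xs : List A) (ys : List B) →
  length (cartesianProductWith f xs ys) ≡ length xs * length ys
length-cartesianProductWith f [] ys = refl
length-cartesianProductWith f (x ∷ xs) ys = begin
  length (List.map (f x) ys List.++ cartesianProductWith f xs ys)  ≡⟨ length-++ (List.map (f x) ys) ⟩
  length (List.map (f x) ys) + length (cartesianProductWith f xs ys) ≡⟨ cong₂ _+_ (length-map (f x) ys) (length-cartesianProductWith f xs ys) ⟩
  length ys + length xs * length ys                                 ∎

count-product : {X Y Z : Set} {P : X → Set} {R : Y → Set} {T : Z → Set} {A B : ℕ}
  (pair : X → Y → Z) →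
  (∀ {x x′ y y′} → pair x y ≡ pair x′ y′ → x ≡ x′ × y ≡ y′) →
  (∀ x y → P x → R y → T (pair x y)) →
  (∀ z → T z → Σ X λ x → Σ Y λ y → P x × R y × z ≡ pair x y) →
  HasCount P A → HasCount R B → HasCount T (A * B)
count-product {P = P} {R} {T} pair injective sound complete (L₁ , u₁ , m₁ , l₁) (L₂ , u₂ , m₂ , l₂) =
  cartesianProductWith pair L₁ L₂ , cartesianProductWith⁺ pair injective u₁ u₂ ,
  (λ z → mk⇔ (member⇒T z) (T⇒member z)) ,
  trans (length-cartesianProductWith pair L₁ L₂) (cong₂ _*_ l₁ l₂)
  where
  member⇒T : ∀ z → z ∈ cartesianProductWith pair L₁ L₂ → T z
  member⇒T z z∈ with ∈-cartesianProductWith⁻ pair L₁ L₂ z∈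
  ... | x , y , x∈ , y∈ , refl = sound x y (Equivalence.to (m₁ x) x∈) (Equivalence.to (m₂ y) y∈)
  T⇒member : ∀ z → T z → z ∈ cartesianProductWith pair L₁ L₂
  T⇒member z tz with complete z tz
  ... | x , y , px , ry , refl = ∈-cartesianProductWith⁺ pair (Equivalence.from (m₁ x) px) (Equivalence.from (m₂ y) ry)

count-bijection : {Y Z : Set} {R : Y → Set} {T : Z → Set} {B : ℕ}
  (g : Y → Z) → (∀ {y y′} → g y ≡ g y′ → y ≡ y′) →
  (∀ y → R y → T (g y)) → (∀ z → T z → Σ Y λ y → R y × z ≡ g y) →
  HasCount R B → HasCount T B
count-bijection {B = B} g injective sound complete count =
  count-≡ (*-identityˡ B) (count-product (λ _ → g) (λ eq → refl , injective eq) (λ _ y _ → sound y)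
    (λ z tz → let (y , ry , z≡) = complete z tz in tt , y , tt , ry , z≡)
    (count-single {P = λ _ → ⊤} tt tt (λ _ _ → refl)) count)

module _ {d : ℕ} .{{_ : NonZero d}} where

  -- For a ≤ b: b = a + (b − a) with d ∣ b − a.
  mod⇒%-≤ : ∀ {a b} → a ≤ b → a ≡ b [mod d ] → a % d ≡ b % d
  mod⇒%-≤ {a} {b} a≤b d∣ = begin
    a % d             ≡⟨ %-remove-+ʳ a (subst (d ∣_) (m≤n⇒∣m-n∣≡n∸m a≤b) d∣) ⟨
    (a + (b ∸ a)) % d ≡⟨ cong (_% d) (m+[n∸m]≡n a≤b) ⟩
    b % d             ∎

  mod⇒% : ∀ {a b} → a ≡ b [mod d ] → a % d ≡ b % d
  mod⇒% {a} {b} d∣ with ≤-total a b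
  ... | inj₁ a≤b = mod⇒%-≤ a≤b d∣
  ... | inj₂ b≤a = sym (mod⇒%-≤ b≤a (subst (d ∣_) (∣-∣-comm a b) d∣))

  -- If a = s + i·d and b = s + j·d then ∣a − b∣ = ∣i − j∣·d.
  %⇒mod : ∀ {a b} → a % d ≡ b % d → a ≡ b [mod d ]
  %⇒mod {a} {b} eq = divides ∣ a / d - b / d ∣ (begin
    ∣ a - b ∣                                 ≡⟨ cong₂ ∣_-_∣ (m≡m%n+[m/n]*n a d) b≡ ⟩
    ∣ a % d + a / d * d - a % d + b / d * d ∣ ≡⟨ ∣m+n-m+o∣≡∣n-o∣ (a % d) (a / d * d) (b / d * d) ⟩
    ∣ a / d * d - b / d * d ∣                 ≡⟨ *-distribʳ-∣-∣ d (a / d) (b / d) ⟨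
    ∣ a / d - b / d ∣ * d                     ∎)
    where
    b≡ : b ≡ a % d + b / d * d
    b≡ = trans (m≡m%n+[m/n]*n b d) (cong (_+ b / d * d) (sym eq))

  %-injective : ∀ {a b} → a < d → b < d → a % d ≡ b % d → a ≡ b
  %-injective {a} {b} a<d b<d eq = begin
    a     ≡⟨ m<n⇒m%n≡m a<d ⟨
    a % d ≡⟨ eq ⟩
    b % d ≡⟨ m<n⇒m%n≡m b<d ⟩
    b     ∎

%-weaken : ∀ {d t} .{{_ : NonZero d}} .{{_ : NonZero t}} → t ∣ d →
  ∀ {a b} → a % d ≡ b % d → a % t ≡ b % t
%-weaken {d} {t} t∣d {a} {b} eq = begin
  a % t     ≡⟨ m∣n⇒o%n%m≡o%m t d a t∣d ⟨
  a % d % t ≡⟨ cong (_% t) eq ⟩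
  b % d % t ≡⟨ m∣n⇒o%n%m≡o%m t d b t∣d ⟩
  b % t     ∎

coprime⇒*∣ : ∀ {q r x} → Coprime q r → q ∣ x → r ∣ x → q * r ∣ x
coprime⇒*∣ {q} {r} c (divides k refl) r∣kq =
  subst (q * r ∣_) (*-comm q k) (*-monoʳ-∣ q (coprime-divisor (Coprimality.sym c) (subst (r ∣_) (*-comm k q) r∣kq)))

∣*⇒∣gcd*gcd : ∀ {d q r} → d ∣ q * r → d ∣ gcd d q * gcd d r
∣*⇒∣gcd*gcd {d} {q} {r} d∣qr = subst (d ∣_) g*gcd[r,d] (gcd-greatest d∣g*r (∣n⇒∣m*n g ∣-refl))
  where
  g : ℕ
  g = gcd d q
  d∣r*gcd[q,d] : d ∣ r * gcd q d
  d∣r*gcd[q,d] = subst (d ∣_) (sym (c*gcd[m,n]≡gcd[cm,cn] r q d))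
    (gcd-greatest (subst (d ∣_) (*-comm q r) d∣qr) (n∣m*n r))
  d∣g*r : d ∣ g * r
  d∣g*r = subst (d ∣_) (trans (*-comm r _) (cong (_* r) (gcd-comm q d))) d∣r*gcd[q,d]
  g*gcd[r,d] : gcd (g * r) (g * d) ≡ g * gcd d r
  g*gcd[r,d] = trans (sym (c*gcd[m,n]≡gcd[cm,cn] g r d)) (cong (g *_) (gcd-comm r d))

coprime-*ʳ : ∀ {a b c} → Coprime a b → Coprime a c → Coprime a (b * c)
coprime-*ʳ {a} {b} {c} a⊥b a⊥c {t} (t∣a , t∣bc) = a⊥c (t∣a , coprime-divisor t⊥b t∣bc)
  where
  t⊥b : Coprime t b
  t⊥b (s∣t , s∣b) = a⊥b (∣-trans s∣t t∣a , s∣b)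

coprime-^ʳ : ∀ {a b} → Coprime a b → ∀ k → Coprime a (b ^ k)
coprime-^ʳ {a} a⊥b zero = Coprimality.sym (1-coprimeTo a)
coprime-^ʳ a⊥b (suc k) = coprime-*ʳ a⊥b (coprime-^ʳ a⊥b k)

coprime-^ˡ : ∀ {a b} → Coprime a b → ∀ k → Coprime (a ^ k) b
coprime-^ˡ a⊥b k = Coprimality.sym (coprime-^ʳ (Coprimality.sym a⊥b) k)

coprime-∏ : ∀ {a ℓ} (f : Fin ℓ → ℕ) → (∀ i → Coprime a (f i)) → Coprime a (∏ f)
coprime-∏ {a} {zero} f a⊥f = Coprimality.sym (1-coprimeTo a)
coprime-∏ {a} {suc ℓ} f a⊥f = coprime-*ʳ (a⊥f zero) (coprime-∏ (f ∘ suc) (a⊥f ∘ suc))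

distinct-primes-coprime : ∀ {p p′} → Prime p → Prime p′ → p ≢ p′ → Coprime p p′
distinct-primes-coprime pp pp′ p≢p′ {t} (t∣p , t∣p′) with prime⇒irreducible pp t∣p
... | inj₁ t≡1 = t≡1
... | inj₂ refl with prime⇒irreducible pp′ t∣p′
...   | inj₁ refl = ⊥-elim (¬prime[1] pp)
...   | inj₂ p≡p′ = ⊥-elim (p≢p′ p≡p′)

prime-power-divisor : ∀ {p} → Prime p → ∀ e {d} → d ∣ p * p ^ e → d ∣ p ^ e ⊎ d ≡ p * p ^ e
prime-power-divisor {p} pp e {d} (divides k pe≡kd) with p ∣? k
... | yes (divides k′ refl) = inj₁ (divides k′ (*-cancelˡ-≡ (p ^ e) (k′ * d) p (begin
  p * p ^ e      ≡⟨ pe≡kd ⟩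
  k′ * p * d     ≡⟨ cong (_* d) (*-comm k′ p) ⟩
  p * k′ * d     ≡⟨ *-assoc p k′ d ⟩
  p * (k′ * d)   ∎)))
  where instance _ = prime⇒nonZero pp
... | no p∤k = inj₂ (begin
  d         ≡⟨ *-identityˡ d ⟨
  1 * d     ≡⟨ cong (_* d) k≡1 ⟨
  k * d     ≡⟨ pe≡kd ⟨
  p * p ^ e ∎)
  where
  -- p ∤ k, so k is coprime to p, hence to p^(e+1), which it divides
  k⊥p : Coprime k p
  k⊥p {t} (t∣k , t∣p) with prime⇒irreducible pp t∣p
  ... | inj₁ t≡1 = t≡1
  ... | inj₂ refl = ⊥-elim (p∤k t∣k)
  k≡1 : k ≡ 1
  k≡1 = coprime-^ʳ k⊥p (suc e) (∣-refl , divides d (trans pe≡kd (*-comm k d)))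

vec-ext : {A : Set} {n : ℕ} (u v : Vec A n) → (∀ i → lookup u i ≡ lookup v i) → u ≡ v
vec-ext u v u≗v = begin
  u                   ≡⟨ tabulate∘lookup u ⟨
  tabulate (lookup u) ≡⟨ tabulate-cong u≗v ⟩
  tabulate (lookup v) ≡⟨ tabulate∘lookup v ⟩
  v                   ∎

zipWith-injective : {A B C : Set} {n : ℕ} (f : A → B → C) →
  (∀ {a a′ b b′} → f a b ≡ f a′ b′ → a ≡ a′ × b ≡ b′) →
  ∀ {u u′ : Vec A n} {v v′ : Vec B n} → zipWith f u v ≡ zipWith f u′ v′ → u ≡ u′ × v ≡ v′
zipWith-injective f f-inj {[]} {[]} {[]} {[]} eq = refl , refl
zipWith-injective f f-inj {_ ∷ _} {_ ∷ _} {_ ∷ _} {_ ∷ _} eq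
  with ∷-injective eq
... | head≡ , tail≡ with f-inj head≡ | zipWith-injective f f-inj tail≡
...   | refl , refl | refl , refl = refl , refl

Periodic : ℕ → {A : Set} {n : ℕ} → Vec A n → Set
Periodic Q {n = n} v = (a b : Fin n) → toℕ a ≡ toℕ b [mod Q ] → lookup v a ≡ lookup v b

periodic-map : ∀ Q {A B : Set} {n} (f : A → B) {v : Vec A n} → Periodic Q v → Periodic Q (map f v)
periodic-map Q f {v} per a b a≡b = begin
  lookup (map f v) a ≡⟨ lookup-map a f v ⟩
  f (lookup v a)     ≡⟨ cong f (per a b a≡b) ⟩
  f (lookup v b)     ≡⟨ lookup-map b f v ⟨
  lookup (map f v) b ∎

module _ (Q′ : ℕ) {A : Set} where
  private Q = suc Q′

  -- In x ∷ v position 0 is congruent to position Q of x ∷ v, i.e. index Q′ of v;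
  -- so x ∷ v is Q-periodic iff v is and x equals that entry (when it exists).
  HeadFits : {n : ℕ} → A → Vec A n → Set
  HeadFits {n} x v = (k : Fin n) → toℕ k ≡ Q′ → x ≡ lookup v k

  periodic-tail : ∀ {n x} {v : Vec A n} → Periodic Q (x ∷ v) → Periodic Q v
  periodic-tail per a b = per (suc a) (suc b)

  periodic-head : ∀ {n x} {v : Vec A n} → Periodic Q (x ∷ v) → HeadFits x v
  periodic-head per k refl = per zero (suc k) (∣-refl)

  class-of-head : ∀ {n} (b : Fin n) → 0 ≡ suc (toℕ b) [mod Q ] →
    Σ (Fin n) λ k → (toℕ k ≡ Q′) × (toℕ k ≡ toℕ b [mod Q ])
  class-of-head {n} b Q∣1+b = fromℕ< Q′<n , toℕ-fromℕ< Q′<n ,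
    subst (λ t → t ≡ toℕ b [mod Q ]) (sym (toℕ-fromℕ< Q′<n))
      (subst (Q ∣_) (sym (m≤n⇒∣m-n∣≡n∸m Q′≤b)) (∣m+n∣m⇒∣n Q∣Q+[b∸Q′] ∣-refl))
    where
    Q′≤b : Q′ ≤ toℕ b
    Q′≤b = ≤-pred (∣⇒≤ Q∣1+b)
    Q′<n : Q′ < n
    Q′<n = ≤-<-trans Q′≤b (toℕ<n b)
    Q∣Q+[b∸Q′] : Q ∣ Q + (toℕ b ∸ Q′)
    Q∣Q+[b∸Q′] = subst (Q ∣_) (cong suc (sym (m+[n∸m]≡n Q′≤b))) Q∣1+b

  -- Conversely, by the previous lemma the head condition covers all pairs of
  -- positions involving position 0.
  periodic-∷ : ∀ {n x} {v : Vec A n} → Periodic Q v → HeadFits x v → Periodic Q (x ∷ v)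
  periodic-∷ {n} {x} {v} per fits = per-∷
    where
    head≡ : (b : Fin n) → 0 ≡ suc (toℕ b) [mod Q ] → x ≡ lookup v b
    head≡ b Q∣1+b with class-of-head b Q∣1+b
    ... | k , k≡Q′ , k≡b = trans (fits k k≡Q′) (per k b k≡b)
    per-∷ : Periodic Q (x ∷ v)
    per-∷ zero    zero    _   = refl
    per-∷ zero    (suc b) a≡b = head≡ b a≡b
    per-∷ (suc a) zero    a≡b = sym (head≡ a (subst (Q ∣_) (∣-∣-comm (suc (toℕ a)) 0) a≡b))
    per-∷ (suc a) (suc b) a≡b = per a b a≡b

  -- A Q-periodic vector of length n over a c-element type is determined by its
  -- first min(n, Q) entries, which are arbitrary.
  periodic-count : ∀ {c} → HasCount {A} (λ _ → ⊤) c → ∀ n → HasCount (Periodic Q {A} {n}) (c ^ (n ⊓ Q))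
  periodic-count count-A zero = count-single [] (λ ()) (λ { [] _ → refl })
  periodic-count {c} count-A (suc n) with Q′ <? n
  ... | yes Q′<n = count-≡ (cong (c ^_) exponent)
        (count-bijection (λ v → lookup v k ∷ v) (∷-injectiveʳ)
          (λ v per → periodic-∷ per (λ k′ k′≡Q′ → cong (lookup v) (toℕ-injective (trans (toℕ-fromℕ< Q′<n) (sym k′≡Q′)))))
          (λ { (x ∷ v) per → v , periodic-tail per , cong (_∷ v) (periodic-head per k (toℕ-fromℕ< Q′<n)) })
          (periodic-count count-A n))
    where
    k : Fin n
    k = fromℕ< Q′<n
    exponent : n ⊓ Q ≡ suc n ⊓ Q
    exponent = trans (m≥n⇒m⊓n≡n Q′<n) (sym (cong suc (m≥n⇒m⊓n≡n (<⇒≤ Q′<n))))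
  ... | no Q′≮n = count-≡ (cong (λ t → c * c ^ t) exponent)
        (count-product _∷_ ∷-injective
          (λ x v _ per → periodic-∷ per (λ k k≡Q′ → ⊥-elim (Q′≮n (subst (_< n) k≡Q′ (toℕ<n k)))))
          (λ { (x ∷ v) per → x , v , tt , periodic-tail per , refl })
          count-A (periodic-count count-A n))
    where
    n≤Q′ : n ≤ Q′
    n≤Q′ = ≮⇒≥ Q′≮n
    exponent : n ⊓ Q ≡ n ⊓ Q′
    exponent = trans (m≤n⇒m⊓n≡m (m≤n⇒m≤1+n n≤Q′)) (sym (m≤n⇒m⊓n≡m n≤Q′))

periodic-count-nonzero : ∀ Q .{{_ : NonZero Q}} {A : Set} {c} → HasCount {A} (λ _ → ⊤) c →
  ∀ n → HasCount (Periodic Q {A} {n}) (c ^ (n ⊓ Q))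
periodic-count-nonzero (suc Q′) = periodic-count Q′

PreservesRemainders : (n m : ℕ) → Vec (Fin m) n → Set
PreservesRemainders n m f =
  ∀ d .{{_ : NonZero d}} → d ∣ m → (a b : Fin n) →
  toℕ a % d ≡ toℕ b % d → toℕ (lookup f a) % d ≡ toℕ (lookup f b) % d

cp⇔preservesRemainders : ∀ {n m} (f : Vec (Fin m) n) → CongruencePreserving n m f ⇔ PreservesRemainders n m f
cp⇔preservesRemainders {n} {m} f = mk⇔ cp⇒pr pr⇒cp
  where
  cp⇒pr : CongruencePreserving n m f → PreservesRemainders n m f
  cp⇒pr cp d d∣m a b a≡b = mod⇒% (cp d (>-nonZero⁻¹ d) d∣m a b (%⇒mod a≡b))
  pr⇒cp : PreservesRemainders n m f → CongruencePreserving n m f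
  pr⇒cp pr d 1≤d d∣m a b a≡b = %⇒mod (pr d d∣m a b (mod⇒% a≡b))
    where instance _ = >-nonZero 1≤d

preservesRemainders⇒periodic : ∀ {n m} .{{_ : NonZero m}} {f : Vec (Fin m) n} →
  PreservesRemainders n m f → Periodic m f
preservesRemainders⇒periodic {m = m} pr a b a≡b =
  toℕ-injective (%-injective (toℕ<n _) (toℕ<n _) (pr m ∣-refl a b (mod⇒% a≡b)))

preservesRemainders-reduce : ∀ {n m s} .{{_ : NonZero s}} → s ∣ m →
  (reduce : Fin m → Fin s) → (∀ x → toℕ (reduce x) ≡ toℕ x % s) →
  {f : Vec (Fin m) n} → PreservesRemainders n m f → PreservesRemainders n s (map reduce f)
preservesRemainders-reduce {s = s} s∣m reduce reduce≡ {f} pr d d∣s a b a≡b = begin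
  toℕ (lookup (map reduce f) a) % d ≡⟨ reduced a ⟩
  toℕ (lookup f a) % d              ≡⟨ pr d (∣-trans d∣s s∣m) a b a≡b ⟩
  toℕ (lookup f b) % d              ≡⟨ reduced b ⟨
  toℕ (lookup (map reduce f) b) % d ∎
  where
  reduced : ∀ a → toℕ (lookup (map reduce f) a) % d ≡ toℕ (lookup f a) % d
  reduced a = begin
    toℕ (lookup (map reduce f) a) % d ≡⟨ cong (λ x → toℕ x % d) (lookup-map a reduce f) ⟩
    toℕ (reduce (lookup f a)) % d     ≡⟨ cong (_% d) (reduce≡ (lookup f a)) ⟩
    toℕ (lookup f a) % s % d          ≡⟨ m∣n⇒o%n%m≡o%m d s _ d∣s ⟩
    toℕ (lookup f a) % d              ∎

constant-zero : ∀ {n} (v : Vec (Fin 1) n) → v ≡ replicate n zero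
constant-zero [] = refl
constant-zero (zero ∷ v) = cong (zero ∷_) (constant-zero v)

count-modulus-1 : ∀ n → HasCount (PreservesRemainders n 1) 1
count-modulus-1 n = count-single (replicate n zero) zero-preserves (λ v _ → constant-zero v)
  where
  zero-preserves : PreservesRemainders n 1 (replicate n zero)
  zero-preserves d _ a b _ = cong (λ x → toℕ x % d) (trans (lookup-replicate a zero) (sym (lookup-replicate b zero)))

module _ {p q : ℕ} .{{_ : NonZero p}} .{{_ : NonZero q}} where
  instance
    pq≢0 : NonZero (p * q)
    pq≢0 = m*n≢0 p q

  toℕ-remainder : (x : Fin (p * q)) → toℕ (remainder {p} q x) ≡ toℕ x % q
  toℕ-remainder x = sym (begin
    toℕ x % q                              ≡⟨ cong (λ y → toℕ y % q) (combine-remQuot {p} q x) ⟨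
    toℕ (combine h g) % q                  ≡⟨ cong (_% q) (toℕ-combine h g) ⟩
    (q * toℕ h + toℕ g) % q                ≡⟨ %-remove-+ˡ (toℕ g) (m∣m*n (toℕ h)) ⟩
    toℕ g % q                              ≡⟨ m<n⇒m%n≡m (toℕ<n g) ⟩
    toℕ g                                  ∎)
    where
    h : Fin p
    h = quotient {p} q x
    g : Fin q
    g = remainder {p} q x

  -- If every divisor of p·q divides q or is p·q itself (as for q = p^e with p
  -- prime), then f ↦ (quotient, remainder) splits a remainder preserving f into
  -- Z/pqZ into an arbitrary pq-periodic vector over Fin p and a remainder
  -- preserving function into Z/qZ.
  count-peel : ∀ {n B} → (∀ {d} → d ∣ p * q → d ∣ q ⊎ d ≡ p * q) →
    HasCount (PreservesRemainders n q) B →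
    HasCount (PreservesRemainders n (p * q)) (p ^ (n ⊓ (p * q)) * B)
  count-peel {n} divisors count-q = count-product (zipWith combine)
      (zipWith-injective combine (λ {h} {h′} {g} {g′} → combine-injective h g h′ g′))
      sound complete (periodic-count-nonzero (p * q) (count-Fin p) n) count-q
    where
    sound : ∀ h g → Periodic (p * q) h → PreservesRemainders n q g →
      PreservesRemainders n (p * q) (zipWith combine h g)
    sound h g per-h pr-g d d∣pq a b a≡b with divisors d∣pq
    ... | inj₁ d∣q = begin
      toℕ (lookup (zipWith combine h g) a) % d ≡⟨ combine-% a ⟩
      toℕ (lookup g a) % d                     ≡⟨ pr-g d d∣q a b a≡b ⟩
      toℕ (lookup g b) % d                     ≡⟨ combine-% b ⟨
      toℕ (lookup (zipWith combine h g) b) % d ∎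
      where
      -- modulo a divisor of q, combine x y = q·x + y is congruent to y
      combine-% : ∀ a → toℕ (lookup (zipWith combine h g) a) % d ≡ toℕ (lookup g a) % d
      combine-% a = begin
        toℕ (lookup (zipWith combine h g) a) % d        ≡⟨ cong (λ x → toℕ x % d) (lookup-zipWith combine a h g) ⟩
        toℕ (combine (lookup h a) (lookup g a)) % d     ≡⟨ cong (_% d) (toℕ-combine (lookup h a) (lookup g a)) ⟩
        (q * toℕ (lookup h a) + toℕ (lookup g a)) % d   ≡⟨ %-remove-+ˡ _ (∣m⇒∣m*n (toℕ (lookup h a)) d∣q) ⟩
        toℕ (lookup g a) % d                            ∎
    ... | inj₂ refl = cong (λ x → toℕ x % (p * q)) (begin
      lookup (zipWith combine h g) a          ≡⟨ lookup-zipWith combine a h g ⟩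
      combine (lookup h a) (lookup g a)       ≡⟨ cong₂ combine (per-h a b a≡b[pq]) (per-g a b (∣-trans (n∣m*n p) a≡b[pq])) ⟩
      combine (lookup h b) (lookup g b)       ≡⟨ lookup-zipWith combine b h g ⟨
      lookup (zipWith combine h g) b          ∎)
      where
      a≡b[pq] : toℕ a ≡ toℕ b [mod p * q ]
      a≡b[pq] = %⇒mod a≡b
      per-g : Periodic q g
      per-g = preservesRemainders⇒periodic {f = g} pr-g
    complete : ∀ f → PreservesRemainders n (p * q) f →
      Σ (Vec (Fin p) n) λ h → Σ (Vec (Fin q) n) λ g →
      Periodic (p * q) h × PreservesRemainders n q g × f ≡ zipWith combine h g
    complete f pr-f = h , g ,
      periodic-map (p * q) (quotient {p} q) {f} (preservesRemainders⇒periodic {f = f} pr-f) ,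
      preservesRemainders-reduce (n∣m*n p) (remainder {p} q) toℕ-remainder {f} pr-f ,
      vec-ext f (zipWith combine h g) split
      where
      h : Vec (Fin p) n
      h = map (quotient {p} q) f
      g : Vec (Fin q) n
      g = map (remainder {p} q) f
      split : ∀ i → lookup f i ≡ lookup (zipWith combine h g) i
      split i = begin
        lookup f i                                                         ≡⟨ combine-remQuot {p} q (lookup f i) ⟨
        combine (quotient {p} q (lookup f i)) (remainder {p} q (lookup f i)) ≡⟨ cong₂ combine (lookup-map i (quotient {p} q) f) (lookup-map i (remainder {p} q) f) ⟨
        combine (lookup h i) (lookup g i)                                  ≡⟨ lookup-zipWith combine i h g ⟨
        lookup (zipWith combine h g) i                                     ∎

cappedPowSum : ℕ → ℕ → ℕ → ℕ
cappedPowSum n p zero    = 0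
cappedPowSum n p (suc e) = cappedPowSum n p e + n ⊓ p ^ suc e

count-prime-power : ∀ n {p} → Prime p → ∀ e →
  HasCount (PreservesRemainders n (p ^ e)) (p ^ cappedPowSum n p e)
count-prime-power n pp zero = count-modulus-1 n
count-prime-power n {p} pp (suc e) =
  count-≡ exponent (count-peel {p} {p ^ e} {{p≢0}} {{m^n≢0 p e {{p≢0}}}} (prime-power-divisor pp e) (count-prime-power n pp e))
  where
  p≢0 : NonZero p
  p≢0 = prime⇒nonZero pp
  exponent : p ^ (n ⊓ (p * p ^ e)) * p ^ cappedPowSum n p e ≡ p ^ cappedPowSum n p (suc e)
  exponent = begin
    p ^ (n ⊓ (p * p ^ e)) * p ^ cappedPowSum n p e ≡⟨ *-comm (p ^ (n ⊓ (p * p ^ e))) _ ⟩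
    p ^ cappedPowSum n p e * p ^ (n ⊓ (p * p ^ e)) ≡⟨ ^-distribˡ-+-* p (cappedPowSum n p e) _ ⟨
    p ^ cappedPowSum n p (suc e)                   ∎

-- Bézout: for coprime q and r some multiple of q is 1 modulo r.
coprime⇒unit : ∀ {q r} .{{_ : NonZero r}} → Coprime q r → Σ ℕ λ e → q ∣ e × e % r ≡ 1 % r
coprime⇒unit {q} {r@(suc r′)} q⊥r with coprime-Bézout q⊥r
... | Bézout.+- x y 1+yr≡xq = x * q , n∣m*n x , (begin
  x * q % r         ≡⟨ cong (_% r) 1+yr≡xq ⟨
  (1 + y * r) % r   ≡⟨ [m+kn]%n≡m%n 1 y r ⟩
  1 % r             ∎)
... | Bézout.-+ x y 1+xq≡yr = x * q * r′ , ∣m⇒∣m*n r′ (n∣m*n x) , (begin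
  -- x·q ≡ −1 (mod r), hence x·q·(r − 1) ≡ 1 (mod r)
  x * q * r′ % r                 ≡⟨ [m+kn]%n≡m%n (x * q * r′) 1 r ⟨
  (x * q * r′ + 1 * r) % r       ≡⟨ cong (_% r) (rearrange x q r′) ⟩
  ((1 + x * q) * r′ + 1) % r     ≡⟨ cong (λ t → (t * r′ + 1) % r) 1+xq≡yr ⟩
  (y * r * r′ + 1) % r           ≡⟨ cong (_% r) (regroup y r′) ⟩
  (1 + y * r′ * r) % r           ≡⟨ [m+kn]%n≡m%n 1 (y * r′) r ⟩
  1 % r                          ∎)
  where
  open +-*-Solver
  rearrange : ∀ x q r′ → x * q * r′ + 1 * suc r′ ≡ (1 + x * q) * r′ + 1
  rearrange = solve 3 (λ x q r′ → x :* q :* r′ :+ con 1 :* (con 1 :+ r′) := (con 1 :+ x :* q) :* r′ :+ con 1) refl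
  regroup : ∀ y r′ → y * suc r′ * r′ + 1 ≡ 1 + y * r′ * suc r′
  regroup = solve 2 (λ y r′ → y :* (con 1 :+ r′) :* r′ :+ con 1 := con 1 :+ y :* r′ :* (con 1 :+ r′)) refl

*-unit-% : ∀ {m} .{{_ : NonZero m}} u e → e % m ≡ 1 % m → u < m → u * e % m ≡ u
*-unit-% {m} u e e≡1 u<m = begin
  u * e % m             ≡⟨ %-distribˡ-* u e m ⟩
  (u % m) * (e % m) % m ≡⟨ cong (λ t → (u % m) * t % m) e≡1 ⟩
  (u % m) * (1 % m) % m ≡⟨ %-distribˡ-* u 1 m ⟨
  u * 1 % m             ≡⟨ cong (_% m) (*-identityʳ u) ⟩
  u % m                 ≡⟨ m<n⇒m%n≡m u<m ⟩
  u                     ∎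

module CRT {q r : ℕ} .{{_ : NonZero q}} .{{_ : NonZero r}} (q⊥r : Coprime q r) where
  instance
    qr≢0 : NonZero (q * r)
    qr≢0 = m*n≢0 q r

  private
    e₁ : ℕ
    e₁ = proj₁ (coprime⇒unit (Coprimality.sym q⊥r))
    r∣e₁ : r ∣ e₁
    r∣e₁ = proj₁ (proj₂ (coprime⇒unit (Coprimality.sym q⊥r)))
    e₁%q : e₁ % q ≡ 1 % q
    e₁%q = proj₂ (proj₂ (coprime⇒unit (Coprimality.sym q⊥r)))
    e₂ : ℕ
    e₂ = proj₁ (coprime⇒unit q⊥r)
    q∣e₂ : q ∣ e₂
    q∣e₂ = proj₁ (proj₂ (coprime⇒unit q⊥r))
    e₂%r : e₂ % r ≡ 1 % r
    e₂%r = proj₂ (proj₂ (coprime⇒unit q⊥r))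

  solution : Fin q → Fin r → ℕ
  solution u v = toℕ u * e₁ + toℕ v * e₂

  solution-%q : ∀ u v → solution u v % q ≡ toℕ u
  solution-%q u v = begin
    (toℕ u * e₁ + toℕ v * e₂) % q ≡⟨ %-remove-+ʳ (toℕ u * e₁) (∣n⇒∣m*n (toℕ v) q∣e₂) ⟩
    toℕ u * e₁ % q                ≡⟨ *-unit-% (toℕ u) e₁ e₁%q (toℕ<n u) ⟩
    toℕ u                         ∎

  solution-%r : ∀ u v → solution u v % r ≡ toℕ v
  solution-%r u v = begin
    (toℕ u * e₁ + toℕ v * e₂) % r ≡⟨ %-remove-+ˡ (toℕ v * e₂) (∣n⇒∣m*n (toℕ u) r∣e₁) ⟩
    toℕ v * e₂ % r                ≡⟨ *-unit-% (toℕ v) e₂ e₂%r (toℕ<n v) ⟩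
    toℕ v                         ∎

  crt : Fin q → Fin r → Fin (q * r)
  crt u v = solution u v mod (q * r)

  crt-% : ∀ {s t} .{{_ : NonZero s}} .{{_ : NonZero t}} → s ∣ q * r → t ∣ s →
    ∀ u v → toℕ (crt u v) % t ≡ solution u v % s % t
  crt-% {s} {t} s∣qr t∣s u v = begin
    toℕ (crt u v) % t                 ≡⟨ cong (_% t) (toℕ-fromℕ< _) ⟩
    solution u v % (q * r) % t        ≡⟨ m∣n⇒o%n%m≡o%m t (q * r) (solution u v) (∣-trans t∣s s∣qr) ⟩
    solution u v % t                  ≡⟨ m∣n⇒o%n%m≡o%m t s (solution u v) t∣s ⟨
    solution u v % s % t              ∎

  crt-%ˡ : ∀ {t} .{{_ : NonZero t}} → t ∣ q → ∀ u v → toℕ (crt u v) % t ≡ toℕ u % t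
  crt-%ˡ t∣q u v = trans (crt-% (m∣m*n r) t∣q u v) (cong (_% _) (solution-%q u v))

  crt-%ʳ : ∀ {t} .{{_ : NonZero t}} → t ∣ r → ∀ u v → toℕ (crt u v) % t ≡ toℕ v % t
  crt-%ʳ t∣r u v = trans (crt-% (n∣m*n q) t∣r u v) (cong (_% _) (solution-%r u v))

  crt-injective : ∀ {u u′ v v′} → crt u v ≡ crt u′ v′ → u ≡ u′ × v ≡ v′
  crt-injective {u} {u′} {v} {v′} eq =
    toℕ-injective (%-injective (toℕ<n u) (toℕ<n u′) (begin
      toℕ u % q          ≡⟨ crt-%ˡ ∣-refl u v ⟨
      toℕ (crt u v) % q  ≡⟨ cong (λ z → toℕ z % q) eq ⟩
      toℕ (crt u′ v′) % q ≡⟨ crt-%ˡ ∣-refl u′ v′ ⟩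
      toℕ u′ % q         ∎)) ,
    toℕ-injective (%-injective (toℕ<n v) (toℕ<n v′) (begin
      toℕ v % r          ≡⟨ crt-%ʳ ∣-refl u v ⟨
      toℕ (crt u v) % r  ≡⟨ cong (λ z → toℕ z % r) eq ⟩
      toℕ (crt u′ v′) % r ≡⟨ crt-%ʳ ∣-refl u′ v′ ⟩
      toℕ v′ % r         ∎))

  crt-mod : (x : Fin (q * r)) → crt (toℕ x mod q) (toℕ x mod r) ≡ x
  crt-mod x = toℕ-injective (%-injective (toℕ<n _) (toℕ<n x)
    (mod⇒% (coprime⇒*∣ q⊥r (%⇒mod (trans (crt-%ˡ ∣-refl (toℕ x mod q) (toℕ x mod r)) (mod-% q)))
                           (%⇒mod (trans (crt-%ʳ ∣-refl (toℕ x mod q) (toℕ x mod r)) (mod-% r))))))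
    where
    mod-% : ∀ s .{{_ : NonZero s}} → toℕ (toℕ x mod s) % s ≡ toℕ x % s
    mod-% s = trans (cong (_% s) (toℕ-fromℕ< _)) (m%n%n≡m%n (toℕ x) s)

  count-crt : ∀ {n A B} → HasCount (PreservesRemainders n q) A → HasCount (PreservesRemainders n r) B →
    HasCount (PreservesRemainders n (q * r)) (A * B)
  count-crt {n} = count-product (zipWith crt) (zipWith-injective crt crt-injective) sound complete
    where
    sound : ∀ f g → PreservesRemainders n q f → PreservesRemainders n r g →
      PreservesRemainders n (q * r) (zipWith crt f g)
    sound f g pr-f pr-g d d∣qr a b a≡b =
      mod⇒% (∣-trans (∣*⇒∣gcd*gcd d∣qr) (coprime⇒*∣ g₁⊥g₂
        (follows-f (gcd d q) {{g₁≢0}} (gcd[m,n]∣m d q) (gcd[m,n]∣n d q))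
        (follows-g (gcd d r) {{g₂≢0}} (gcd[m,n]∣m d r) (gcd[m,n]∣n d r))))
      where
      -- d divides gcd(d,q)·gcd(d,r), a product of coprime divisors of q and r
      g₁≢0 : NonZero (gcd d q)
      g₁≢0 = ≢-nonZero (gcd[m,n]≢0 d q (inj₂ (≢-nonZero⁻¹ q)))
      g₂≢0 : NonZero (gcd d r)
      g₂≢0 = ≢-nonZero (gcd[m,n]≢0 d r (inj₂ (≢-nonZero⁻¹ r)))
      g₁⊥g₂ : Coprime (gcd d q) (gcd d r)
      g₁⊥g₂ (t∣g₁ , t∣g₂) = q⊥r (∣-trans t∣g₁ (gcd[m,n]∣n d q) , ∣-trans t∣g₂ (gcd[m,n]∣n d r))
      F : Vec (Fin (q * r)) n
      F = zipWith crt f g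
      follows-f : ∀ t .{{_ : NonZero t}} → t ∣ d → t ∣ q → toℕ (lookup F a) ≡ toℕ (lookup F b) [mod t ]
      follows-f t t∣d t∣q = %⇒mod (begin
        toℕ (lookup F a) % t                    ≡⟨ cong (λ z → toℕ z % t) (lookup-zipWith crt a f g) ⟩
        toℕ (crt (lookup f a) (lookup g a)) % t ≡⟨ crt-%ˡ t∣q (lookup f a) (lookup g a) ⟩
        toℕ (lookup f a) % t                    ≡⟨ pr-f t t∣q a b (%-weaken t∣d a≡b) ⟩
        toℕ (lookup f b) % t                    ≡⟨ crt-%ˡ t∣q (lookup f b) (lookup g b) ⟨
        toℕ (crt (lookup f b) (lookup g b)) % t ≡⟨ cong (λ z → toℕ z % t) (lookup-zipWith crt b f g) ⟨
        toℕ (lookup F b) % t                    ∎)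
      follows-g : ∀ t .{{_ : NonZero t}} → t ∣ d → t ∣ r → toℕ (lookup F a) ≡ toℕ (lookup F b) [mod t ]
      follows-g t t∣d t∣r = %⇒mod (begin
        toℕ (lookup F a) % t                    ≡⟨ cong (λ z → toℕ z % t) (lookup-zipWith crt a f g) ⟩
        toℕ (crt (lookup f a) (lookup g a)) % t ≡⟨ crt-%ʳ t∣r (lookup f a) (lookup g a) ⟩
        toℕ (lookup g a) % t                    ≡⟨ pr-g t t∣r a b (%-weaken t∣d a≡b) ⟩
        toℕ (lookup g b) % t                    ≡⟨ crt-%ʳ t∣r (lookup f b) (lookup g b) ⟨
        toℕ (crt (lookup f b) (lookup g b)) % t ≡⟨ cong (λ z → toℕ z % t) (lookup-zipWith crt b f g) ⟨
        toℕ (lookup F b) % t                    ∎)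
    complete : ∀ F → PreservesRemainders n (q * r) F →
      Σ (Vec (Fin q) n) λ f → Σ (Vec (Fin r) n) λ g →
      PreservesRemainders n q f × PreservesRemainders n r g × F ≡ zipWith crt f g
    complete F pr-F = f , g ,
      preservesRemainders-reduce (m∣m*n r) modq (λ x → toℕ-fromℕ< _) {F} pr-F ,
      preservesRemainders-reduce (n∣m*n q) modr (λ x → toℕ-fromℕ< _) {F} pr-F ,
      vec-ext F (zipWith crt f g) split
      where
      modq : Fin (q * r) → Fin q
      modq x = toℕ x mod q
      modr : Fin (q * r) → Fin r
      modr x = toℕ x mod r
      f : Vec (Fin q) n
      f = map modq F
      g : Vec (Fin r) n
      g = map modr F
      split : ∀ i → lookup F i ≡ lookup (zipWith crt f g) i
      split i = begin
        lookup F i                                     ≡⟨ crt-mod (lookup F i) ⟨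
        crt (modq (lookup F i)) (modr (lookup F i))    ≡⟨ cong₂ crt (lookup-map i modq F) (lookup-map i modr F) ⟨
        crt (lookup f i) (lookup g i)                  ≡⟨ lookup-zipWith crt i f g ⟨
        lookup (zipWith crt f g) i                     ∎

∏-nonZero : ∀ {ℓ} (f : Fin ℓ → ℕ) → (∀ i → NonZero (f i)) → NonZero (∏ f)
∏-nonZero {zero} f f≢0 = _
∏-nonZero {suc ℓ} f f≢0 = m*n≢0 (f zero) (∏ (f ∘ suc)) {{f≢0 zero}} {{∏-nonZero (f ∘ suc) (f≢0 ∘ suc)}}

∏-cong : ∀ {ℓ} {f g : Fin ℓ → ℕ} → (∀ i → f i ≡ g i) → ∏ f ≡ ∏ g
∏-cong {zero} f≗g = refl
∏-cong {suc ℓ} f≗g = cong₂ _*_ (f≗g zero) (∏-cong (f≗g ∘ suc))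

count-∏ : ∀ n {ℓ} (m c : Fin ℓ → ℕ) → (m≢0 : ∀ i → NonZero (m i)) →
  (∀ i j → i ≢ j → Coprime (m i) (m j)) →
  (∀ i → HasCount (PreservesRemainders n (m i)) (c i)) →
  HasCount (PreservesRemainders n (∏ m)) (∏ c)
count-∏ n {zero} m c m≢0 coprime count = count-modulus-1 n
count-∏ n {suc ℓ} m c m≢0 coprime count =
  CRT.count-crt {{m≢0 zero}} {{∏-nonZero (m ∘ suc) (m≢0 ∘ suc)}}
    (coprime-∏ (m ∘ suc) (λ i → coprime zero (suc i) zero≢suc))
    (count zero)
    (count-∏ n (m ∘ suc) (c ∘ suc) (m≢0 ∘ suc) (λ i j i≢j → coprime (suc i) (suc j) (i≢j ∘ Fin-suc-injective)) (count ∘ suc))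

-- While p^e ≤ n no term of the capped sum is capped.
cappedPowSum-small : ∀ n p .{{_ : NonZero p}} e → p ^ e ≤ n → cappedPowSum n p e ≡ powSum p e
cappedPowSum-small n p zero    _      = refl
cappedPowSum-small n p (suc e) pᵉ⁺¹≤n =
  cong₂ _+_ (cappedPowSum-small n p e (≤-trans (m≤n*m (p ^ e) p) pᵉ⁺¹≤n)) (m≥n⇒m⊓n≡n pᵉ⁺¹≤n)

-- Beyond the largest power p^l ≤ n every term is capped at n.
cappedPowSum-large : ∀ n p .{{_ : NonZero p}} l → p ^ l ≤ n → n < p ^ (l + 1) →
  ∀ k → cappedPowSum n p (k + l) ≡ powSum p l + k * n
cappedPowSum-large n p l pˡ≤n n<pˡ⁺¹ zero = trans (cappedPowSum-small n p l pˡ≤n) (sym (+-identityʳ _))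
cappedPowSum-large n p l pˡ≤n n<pˡ⁺¹ (suc k) = begin
  cappedPowSum n p (k + l) + n ⊓ p ^ suc (k + l) ≡⟨ cong₂ _+_ (cappedPowSum-large n p l pˡ≤n n<pˡ⁺¹ k) capped ⟩
  powSum p l + k * n + n                         ≡⟨ +-assoc (powSum p l) (k * n) n ⟩
  powSum p l + (k * n + n)                       ≡⟨ cong (powSum p l +_) (+-comm (k * n) n) ⟩
  powSum p l + suc k * n                         ∎
  where
  capped : n ⊓ p ^ suc (k + l) ≡ n
  capped = m≤n⇒m⊓n≡m (<⇒≤ (<-≤-trans n<pˡ⁺¹ (^-monoʳ-≤ p (subst (_≤ suc (k + l)) (+-comm 1 l) (s≤s (m≤n+m l k))))))

cappedPowSum-cases : ∀ n p .{{_ : NonZero p}} e l → p ^ l ≤ n → n < p ^ (l + 1) →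
  p ^ cappedPowSum n p e ≡ (if ⌊ p ^ e ≤? n ⌋ then p ^ powSum p e else p ^ (powSum p l + n * (e ∸ l)))
cappedPowSum-cases n p e l pˡ≤n n<pˡ⁺¹ with p ^ e ≤? n
... | yes pᵉ≤n = cong (p ^_) (cappedPowSum-small n p e pᵉ≤n)
... | no pᵉ≰n = cong (p ^_) (begin
  cappedPowSum n p e           ≡⟨ cong (cappedPowSum n p) (m∸n+n≡m l≤e) ⟨
  cappedPowSum n p (e ∸ l + l) ≡⟨ cappedPowSum-large n p l pˡ≤n n<pˡ⁺¹ (e ∸ l) ⟩
  powSum p l + (e ∸ l) * n     ≡⟨ cong (powSum p l +_) (*-comm (e ∸ l) n) ⟩
  powSum p l + n * (e ∸ l)     ∎)
  where
  l≤e : l ≤ e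
  l≤e = ≮⇒≥ (λ e<l → pᵉ≰n (≤-trans (^-monoʳ-≤ p (<⇒≤ e<l)) pˡ≤n))

≤-maxF : ∀ {ℓ} (f : Fin ℓ → ℕ) i → f i ≤ maxF f
≤-maxF f zero    = m≤m⊔n (f zero) _
≤-maxF f (suc i) = ≤-trans (≤-maxF (f ∘ suc) i) (m≤n⊔m (f zero) _)

proposition4p1 : (n m : ℕ) → 1 ≤ n → 1 ≤ m →
    (ℓ : ℕ) (p e : Fin ℓ → ℕ) →
    ((i : Fin ℓ) → Prime (p i)) → ((i : Fin ℓ) → 1 ≤ e i) →
    Injective _≡_ _≡_ p →
    m ≡ ∏ (λ i → p i ^ e i) →
    (l : Fin ℓ → ℕ) →
    ((i : Fin ℓ) → (p i ^ l i ≤ n) × (n < p i ^ (l i + 1))) →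
    (maxF (λ i → p i ^ e i) ≤ n →
      CPCount n m (∏ (λ i → p i ^ powSum (p i) (e i))))
    ×
    (n < maxF (λ i → p i ^ e i) →
      CPCount n m
        (∏ (λ i → if ⌊ p i ^ e i ≤? n ⌋
                  then p i ^ powSum (p i) (e i)
                  else p i ^ (powSum (p i) (l i) + n * (e i ∸ l i)))))
proposition4p1 n m _ _ ℓ p e prime _ distinct refl l l-bounds = small-case , large-case
  where
  p≢0 : ∀ i → NonZero (p i)
  p≢0 i = prime⇒nonZero (prime i)
  count : CPCount n m (∏ (λ i → p i ^ cappedPowSum n (p i) (e i)))
  count = count-⇔ (λ f → ⇔.sym (cp⇔preservesRemainders f))
    (count-∏ n (λ i → p i ^ e i) _ (λ i → m^n≢0 (p i) (e i) {{p≢0 i}})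
      (λ i j i≢j → coprime-^ˡ (coprime-^ʳ (distinct-primes-coprime (prime i) (prime j) (i≢j ∘ distinct)) (e j)) (e i))
      (λ i → count-prime-power n (prime i) (e i)))
  small-case : maxF (λ i → p i ^ e i) ≤ n → CPCount n m (∏ (λ i → p i ^ powSum (p i) (e i)))
  small-case max≤n = count-≡ (∏-cong λ i → cong (p i ^_)
    (cappedPowSum-small n (p i) {{p≢0 i}} (e i) (≤-trans (≤-maxF (λ j → p j ^ e j) i) max≤n))) count
  large-case : n < maxF (λ i → p i ^ e i) → CPCount n m
    (∏ (λ i → if ⌊ p i ^ e i ≤? n ⌋ then p i ^ powSum (p i) (e i) else p i ^ (powSum (p i) (l i) + n * (e i ∸ l i))))
  large-case _ = count-≡ (∏-cong λ i →
    cappedPowSum-cases n (p i) {{p≢0 i}} (e i) (l i) (proj₁ (l-bounds i)) (proj₂ (l-bounds i))) count
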